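{- Let $c_\theta$ be the Fibonacci word and let $w$ be a finite non-empty factor of $c_\theta$. Let $|x|$ be the least period of $w$, where $x$ is the prefix of $w$ of that length, and write $w=x^f$ with $f=|w|/|x|\in\mathbb{Q}$. Suppose that $w$ also has a period $|z|$ with $|x|<|z|$, where $z$ is the prefix of $w$ of length $|z|$, that $z$ is primitive, and write $w=z^e$ with $e=|w|/|z|\in\mathbb{Q}$. Then $e<1+\phi/2$, where $\phi=(1+\sqrt5)/2$.
   Context: The Fibonacci word $c_\theta=010010100100101001010\cdots$ is the fixed point of the morphism $0\mapsto 01$, $1\mapsto 0$ (equivalently, the characteristic Sturmian word of slope $1/\phi^2=[0,2,1,1,1,\ldots]$). For a finite word $u=u_0\cdots u_{n-1}$, a positive integer $p$ is a period of $u$ if $u_i=u_{i+p}$ whenever both indices are defined; if $z$ is the prefix of $u$ of length $p$ we write $u=z^{|u|/p}$ and call $|u|/p$ the exponent. A word is primitive if it is not of the form $v^m$ for a word $v$ and an integer $m\ge2$. -}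

module Defs where

open import Data.Bool using (Bool; true; false)
open import Data.Nat using (ℕ; zero; suc; _+_; _*_; _∸_; _<_; _≤_)
open import Data.List using (List; []; _∷_; concatMap; length; map; upTo; take; concat; replicate)
open import Data.Maybe using (Maybe; just; nothing)
open import Data.Product using (_×_; ∃)
open import Relation.Binary.PropositionalEquality using (_≡_; _≢_)

-- Letters: false = 0, true = 1.
-- The Fibonacci morphism 0 ↦ 01, 1 ↦ 0.
μ : Bool → List Bool
μ false = false ∷ true ∷ []
μ true  = false ∷ []

-- Iterates μᵏ(0); each is a prefix of the next, and |μᵏ(0)| = F_{k+2} ≥ k+1.
μ^ : ℕ → List Bool
μ^ zero    = false ∷ []
μ^ (suc k) = concatMap μ (μ^ k)

index : List Bool → ℕ → Bool
index []       _       = false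
index (x ∷ xs) zero    = x
index (x ∷ xs) (suc i) = index xs i

-- The Fibonacci word c_θ = 0100101001001… as an infinite sequence:
-- letter i is the i-th letter of μ^{i+1}(0), which has length ≥ i+2 > i,
-- so the default of `index` is never used.
fib : ℕ → Bool
fib i = index (μ^ (suc i)) i

Factor : List Bool → Set
Factor w = ∃ λ i → w ≡ map (λ k → fib (i + k)) (upTo (length w))

_!_ : List Bool → ℕ → Maybe Bool
[]       ! _     = nothing
(x ∷ xs) ! zero  = just x
(x ∷ xs) ! suc i = xs ! i

HasPeriod : List Bool → ℕ → Set
HasPeriod w p = (0 < p) × (∀ i → i + p < length w → w ! i ≡ w ! (i + p))

LeastPeriod : List Bool → ℕ → Set
LeastPeriod w p = HasPeriod w p × (∀ q → HasPeriod w q → p ≤ q)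

Primitive : List Bool → Set
Primitive z = ∀ (v : List Bool) (m : ℕ) → 2 ≤ m → z ≢ concat (replicate m v)

-- For naturals q ≤ n with q > 0:  n/q < 1 + φ/2, φ = (1+√5)/2.
-- Setting a = 2(n-q) ≥ 0, this is  a/q < φ, and since φ is the positive
-- root of x² = x + 1 (and irrational), for a ≥ 0 this holds iff a² < a·q + q².
ExpBelowOnePlusHalfPhi : ℕ → ℕ → Set
ExpBelowOnePlusHalfPhi n q =
  let a = 2 * (n ∸ q) in a * a < a * q + q * q

-- If p + q ≤ |w| then q − p is again a period, so p ∣ q and take q w would be a
-- proper power of take p w; hence |w| < p + q.  With d = q − p and m = |w| − q,
-- the occurrence of w makes c_θ agree with its shift by d on a stretch of length m
-- starting p letters into w.  In c_θ such a run has m + 2 < 4d: as c_θ = μ(c_θ),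
-- counting 0s turns a run starting at a block boundary into a run with period
-- d′ = (number of 0s in a period), where 1 ≤ d′ < d and 4d′ ≤ m′ + 2 persists, and
-- at d = 1 the run would contain 11 or 000.  So m < p and m ≤ 4d, whence
-- 5·2m < 8q: the ratio 2m/q is below 8/5 < φ.

module Submission where

open import Defs
open import Data.Bool using (Bool; true; false; not)
open import Data.Bool.Properties using (not-injective; not-¬)
open import Data.Empty using (⊥; ⊥-elim)
open import Data.List
  using (List; []; _∷_; _++_; length; concatMap; map; upTo; applyUpTo; take; drop; concat; replicate)
open import Data.List.Properties
  using (++-assoc; ++-identityʳ; concatMap-++; map-upTo; length-drop; take-[])
open import Data.Maybe using (just)
open import Data.Maybe.Properties using (just-injective)
open import Data.Nat hiding (_!)
open import Data.Nat.Properties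
open import Data.Nat.Divisibility using (_∣_; divides; _∣0; ∣-refl; ∣m∣n⇒∣m+n)
open import Data.Nat.Induction using (<-rec)
open import Data.Nat.Tactic.RingSolver using (solve-∀)
open import Data.Product using (_×_; _,_; ∃; proj₁; proj₂)
open import Data.Sum using (_⊎_; inj₁; inj₂)
open import Function using (_∘_)
open import Relation.Binary.PropositionalEquality
open import Relation.Nullary using (¬_; yes; no; contradiction)

-- Periods of finite words

take-+ : ∀ {A : Set} a b (xs : List A) → take (a + b) xs ≡ take a xs ++ take b (drop a xs)
take-+ zero    b xs       = refl
take-+ (suc a) b []       = sym (take-[] b)
take-+ (suc a) b (x ∷ xs) = cong (x ∷_) (take-+ a b xs)

drop-! : ∀ a (xs : List Bool) j → drop a xs ! j ≡ xs ! (a + j)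
drop-! zero    xs       j = refl
drop-! (suc a) []       j = refl
drop-! (suc a) (x ∷ xs) j = drop-! a xs j

take-cong-! : ∀ n {xs ys : List Bool} → n ≤ length xs → n ≤ length ys →
              (∀ j → j < n → xs ! j ≡ ys ! j) → take n xs ≡ take n ys
take-cong-! zero    _ _ _ = refl
take-cong-! (suc n) {x ∷ xs} {y ∷ ys} (s≤s n≤xs) (s≤s n≤ys) xs≗ys =
  cong₂ _∷_ (just-injective (xs≗ys 0 z<s)) (take-cong-! n n≤xs n≤ys (λ j j<n → xs≗ys (suc j) (s≤s j<n)))

take-period : ∀ {w p} → HasPeriod w p → ∀ t → t * p ≤ length w →
              take (t * p) w ≡ concat (replicate t (take p w))
take-period         _                zero    _     = refl
take-period {w} {p} per@(_ , per-p) (suc t) tp≤n = begin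
  take (p + t * p) w                   ≡⟨ take-+ p (t * p) w ⟩
  take p w ++ take (t * p) (drop p w)  ≡⟨ cong (take p w ++_) (take-cong-! (t * p) tp≤|drop| tp≤n′ drop≗w) ⟩
  take p w ++ take (t * p) w           ≡⟨ cong (take p w ++_) (take-period per t tp≤n′) ⟩
  take p w ++ concat (replicate t (take p w)) ∎
  where
  open ≡-Reasoning
  tp≤n′ : t * p ≤ length w
  tp≤n′ = ≤-trans (m≤n+m (t * p) p) tp≤n
  tp+p≤n : t * p + p ≤ length w
  tp+p≤n = subst (_≤ length w) (+-comm p (t * p)) tp≤n
  tp≤|drop| : t * p ≤ length (drop p w)
  tp≤|drop| = subst (t * p ≤_) (sym (length-drop p w)) (m+n≤o⇒m≤o∸n (t * p) tp+p≤n)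
  drop≗w : ∀ j → j < t * p → drop p w ! j ≡ w ! j
  drop≗w j j<tp = trans (drop-! p w j) (trans (cong (w !_) (+-comm p j))
    (sym (per-p j (<-≤-trans (+-monoˡ-< p j<tp) tp+p≤n))))

period-difference : ∀ {w p d} → HasPeriod w p → HasPeriod w (p + d) → 0 < d →
                    p + (p + d) ≤ length w → HasPeriod w d
period-difference {w} {p} {d} (_ , per-p) (_ , per-pd) 0<d bound = 0<d , per-d
  where
  open ≡-Reasoning
  per-d : ∀ j → j + d < length w → w ! j ≡ w ! (j + d)
  per-d j j+d<n with p ≤? j
  ... | no p≰j = begin
    w ! j               ≡⟨ per-pd j j+p+d<n ⟩
    w ! (j + (p + d))   ≡⟨ cong (w !_) shuffle ⟩
    w ! (j + d + p)     ≡⟨ per-p (j + d) (subst (_< length w) shuffle j+p+d<n) ⟨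
    w ! (j + d)         ∎
    where
    j+p+d<n : j + (p + d) < length w
    j+p+d<n = <-≤-trans (+-monoˡ-< (p + d) (≰⇒> p≰j)) bound
    shuffle : j + (p + d) ≡ j + d + p
    shuffle = trans (cong (j +_) (+-comm p d)) (sym (+-assoc j d p))
  ... | yes p≤j with m≤n⇒∃[o]m+o≡n p≤j
  ...   | j′ , refl = begin
    w ! (p + j′)        ≡⟨ cong (w !_) (+-comm p j′) ⟩
    w ! (j′ + p)        ≡⟨ per-p j′ (subst (_< length w) (+-comm p j′) (≤-<-trans (m≤m+n (p + j′) d) j+d<n)) ⟨
    w ! j′              ≡⟨ per-pd j′ (subst (_< length w) (sym shuffle) j+d<n) ⟩
    w ! (j′ + (p + d))  ≡⟨ cong (w !_) shuffle ⟩
    w ! (p + j′ + d)    ∎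
    where
    shuffle : j′ + (p + d) ≡ p + j′ + d
    shuffle = trans (sym (+-assoc j′ p d)) (cong (_+ d) (+-comm j′ p))

leastPeriod-∣ : ∀ {w p} → LeastPeriod w p → ∀ q → HasPeriod w q → p + q ≤ length w → p ∣ q
leastPeriod-∣ {w} {p} (per-p , least) = <-rec _ step
  where
  step : ∀ q → (∀ {q′} → q′ < q → HasPeriod w q′ → p + q′ ≤ length w → p ∣ q′) →
         HasPeriod w q → p + q ≤ length w → p ∣ q
  step q rec per-q p+q≤n with m≤n⇒∃[o]m+o≡n (least q per-q)
  ... | zero  , refl = ∣m∣n⇒∣m+n ∣-refl (p ∣0)
  ... | suc d , refl = ∣m∣n⇒∣m+n ∣-refl
    (rec (m<n+m (suc d) (proj₁ per-p)) (period-difference {w} per-p per-q z<s p+q≤n)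
         (≤-trans (m≤n+m _ p) p+q≤n))

primitive⇒length<p+q : ∀ {w p q} → LeastPeriod w p → HasPeriod w q → p < q → q ≤ length w →
                       Primitive (take q w) → length w < p + q
primitive⇒length<p+q {w} {p} {q} lp per-q p<q q≤n prim with p + q ≤? length w
... | no p+q≰n = ≰⇒> p+q≰n
... | yes p+q≤n with leastPeriod-∣ {w} lp q per-q p+q≤n
...   | divides zero          q≡0  = contradiction q≡0 (>⇒≢ (proj₁ per-q))
...   | divides (suc zero)    q≡p  = contradiction (trans q≡p (+-identityʳ p)) (>⇒≢ p<q)
...   | divides (suc (suc t)) q≡tp =
  contradiction (trans (cong (λ l → take l w) q≡tp)
                       (take-period {w} (proj₁ lp) (2 + t) (subst (_≤ length w) q≡tp q≤n)))
                (prim (take p w) (2 + t) (s≤s (s≤s z≤n)))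

-- The Fibonacci word as a fixed point of μ

_⊑_ : List Bool → List Bool → Set
xs ⊑ ys = ∃ λ t → ys ≡ xs ++ t

⊑-trans : ∀ {xs ys zs} → xs ⊑ ys → ys ⊑ zs → xs ⊑ zs
⊑-trans {xs} (t , refl) (u , refl) = t ++ u , ++-assoc xs t u

index-⊑ : ∀ {xs ys} j → xs ⊑ ys → j < length xs → index ys j ≡ index xs j
index-⊑ {x ∷ xs} zero    (t , refl) _         = refl
index-⊑ {x ∷ xs} (suc j) (t , refl) (s≤s j<) = index-⊑ {xs} j (t , refl) j<

μ^-⊑-suc : ∀ k → μ^ k ⊑ μ^ (suc k)
μ^-⊑-suc zero = true ∷ [] , refl
μ^-⊑-suc (suc k) with μ^-⊑-suc k
... | t , eq = concatMap μ t , trans (cong (concatMap μ) eq) (concatMap-++ μ (μ^ k) t)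

μ^-⊑-+ : ∀ l k → μ^ k ⊑ μ^ (l + k)
μ^-⊑-+ zero    k = [] , sym (++-identityʳ (μ^ k))
μ^-⊑-+ (suc l) k = ⊑-trans (μ^-⊑-+ l k) (μ^-⊑-suc (l + k))

μ^-head : ∀ k → ∃ λ r → μ^ k ≡ false ∷ r
μ^-head zero = [] , refl
μ^-head (suc k) with μ^-head k
... | r , eq = true ∷ concatMap μ r , cong (concatMap μ) eq

length-concatMap-μ : ∀ xs → length xs ≤ length (concatMap μ xs)
length-concatMap-μ []           = z≤n
length-concatMap-μ (false ∷ xs) = m≤n⇒m≤1+n (s≤s (length-concatMap-μ xs))
length-concatMap-μ (true ∷ xs)  = s≤s (length-concatMap-μ xs)

length-μ^ : ∀ k → k < length (μ^ k)
length-μ^ zero = s≤s z≤n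
length-μ^ (suc k) with μ^ k | μ^-head k | length-μ^ k
... | .(false ∷ r) | r , refl | s≤s k≤|r| = s≤s (s≤s (≤-trans k≤|r| (length-concatMap-μ r)))

fib≡index-μ^ : ∀ K {j} → j < length (μ^ K) → fib j ≡ index (μ^ K) j
fib≡index-μ^ K {j} j< = begin
  index (μ^ (suc j)) j      ≡⟨ index-⊑ j (μ^-⊑-+ K (suc j)) (<-trans (n<1+n j) (length-μ^ (suc j))) ⟨
  index (μ^ (K + suc j)) j  ≡⟨ cong (λ l → index (μ^ l) j) (+-comm K (suc j)) ⟩
  index (μ^ (suc j + K)) j  ≡⟨ index-⊑ j (μ^-⊑-+ (suc j) K) j< ⟩
  index (μ^ K) j            ∎
  where open ≡-Reasoning

χ₀ : Bool → ℕ
χ₀ false = 1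
χ₀ true  = 0

χ₀≤1 : ∀ x → χ₀ x ≤ 1
χ₀≤1 false = ≤-refl
χ₀≤1 true  = z≤n

zeros : (ℕ → Bool) → ℕ → ℕ → ℕ
zeros f i zero    = 0
zeros f i (suc n) = χ₀ (f i) + zeros f (suc i) n

zeros-+ : ∀ f i a n → zeros f i (a + n) ≡ zeros f i a + zeros f (i + a) n
zeros-+ f i zero    n = cong (λ j → zeros f j n) (sym (+-identityʳ i))
zeros-+ f i (suc a) n = begin
  χ₀ (f i) + zeros f (suc i) (a + n)                      ≡⟨ cong (χ₀ (f i) +_) (zeros-+ f (suc i) a n) ⟩
  χ₀ (f i) + (zeros f (suc i) a + zeros f (suc i + a) n)  ≡⟨ +-assoc (χ₀ (f i)) _ _ ⟨
  zeros f i (suc a) + zeros f (suc i + a) n               ≡⟨ cong (λ j → zeros f i (suc a) + zeros f j n) (+-suc i a) ⟨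
  zeros f i (suc a) + zeros f (i + suc a) n               ∎
  where open ≡-Reasoning

zeros-snoc : ∀ f i n → zeros f i (suc n) ≡ zeros f i n + χ₀ (f (i + n))
zeros-snoc f i n = begin
  zeros f i (suc n)                  ≡⟨ cong (zeros f i) (+-comm 1 n) ⟩
  zeros f i (n + 1)                  ≡⟨ zeros-+ f i n 1 ⟩
  zeros f i n + (χ₀ (f (i + n)) + 0) ≡⟨ cong (zeros f i n +_) (+-identityʳ _) ⟩
  zeros f i n + χ₀ (f (i + n))       ∎
  where open ≡-Reasoning

zeros-cong : ∀ {f g} i n → (∀ j → j < i + n → f j ≡ g j) → zeros f i n ≡ zeros g i n
zeros-cong i zero    _  = refl
zeros-cong i (suc n) f≗g = cong₂ _+_
  (cong χ₀ (f≗g i (m<m+n i (s≤s z≤n))))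
  (zeros-cong (suc i) n (λ j j< → f≗g j (subst (j <_) (sym (+-suc i n)) j<)))

zeros-≤ : ∀ f i n → zeros f i n ≤ n
zeros-≤ f i zero    = z≤n
zeros-≤ f i (suc n) = +-mono-≤ (χ₀≤1 (f i)) (zeros-≤ f (suc i) n)

zeros-mono : ∀ f i {a b} → a ≤ b → zeros f i a ≤ zeros f i b
zeros-mono f i {a} a≤b with m≤n⇒∃[o]m+o≡n a≤b
... | o , refl = subst (zeros f i a ≤_) (sym (zeros-+ f i a o)) (m≤m+n _ _)

zeros-< : ∀ f i {n} t → t < n → f (t + i) ≡ true → zeros f i n < n
zeros-< f i {suc n} zero    _         fi≡1 rewrite fi≡1 = s≤s (zeros-≤ f (suc i) n)
zeros-< f i {suc n} (suc t) (s≤s t<n) fti≡1 =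
  +-mono-≤-< (χ₀≤1 (f i)) (zeros-< f (suc i) t t<n (subst (λ j → f j ≡ true) (sym (+-suc t i)) fti≡1))

zeros-slide : ∀ f i d → f i ≡ f (i + d) → zeros f (suc i) d ≡ zeros f i d
zeros-slide f i d fi≡fi+d = +-cancelˡ-≡ (χ₀ (f i)) _ _ (begin
  χ₀ (f i) + zeros f (suc i) d  ≡⟨ zeros-snoc f i d ⟩
  zeros f i d + χ₀ (f (i + d))  ≡⟨ cong (λ x → zeros f i d + χ₀ x) fi≡fi+d ⟨
  zeros f i d + χ₀ (f i)        ≡⟨ +-comm (zeros f i d) _ ⟩
  χ₀ (f i) + zeros f i d        ∎)
  where open ≡-Reasoning

zeros-∷ : ∀ x xs i n → zeros (index (x ∷ xs)) (suc i) n ≡ zeros (index xs) i n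
zeros-∷ x xs i zero    = refl
zeros-∷ x xs i (suc n) = cong (χ₀ (index xs i) +_) (zeros-∷ x xs (suc i) n)

index-concatMap-μ-0 : ∀ xs → index (concatMap μ xs) 0 ≡ false
index-concatMap-μ-0 []           = refl
index-concatMap-μ-0 (false ∷ xs) = refl
index-concatMap-μ-0 (true ∷ xs)  = refl

index-concatMap-μ : ∀ xs k → k < length xs → let j = k + zeros (index xs) 0 k in
  index (concatMap μ xs) j ≡ false × index (concatMap μ xs) (suc j) ≡ not (index xs k)
index-concatMap-μ (false ∷ xs) zero    _ = refl , refl
index-concatMap-μ (true ∷ xs)  zero    _ = refl , index-concatMap-μ-0 xs
index-concatMap-μ (false ∷ xs) (suc k) (s≤s k<)
  rewrite zeros-∷ false xs 0 k | +-suc k (zeros (index xs) 0 k) = index-concatMap-μ xs k k<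
index-concatMap-μ (true ∷ xs)  (suc k) (s≤s k<)
  rewrite zeros-∷ true xs 0 k = index-concatMap-μ xs k k<

-- As c_θ = μ(c_θ), letter k of c_θ expands to the block μ(fib k) starting at
-- blockStart k.  Each block has exactly one 0, its first letter, so rank j, the
-- number of 0s before position j, is the number of blocks starting before j.
rank : ℕ → ℕ
rank = zeros fib 0

blockStart : ℕ → ℕ
blockStart k = k + rank k

fib-block : ∀ k → fib (blockStart k) ≡ false × fib (suc (blockStart k)) ≡ not (fib k)
fib-block k = via-μ^ (m≤n⇒m≤1+n bs≤K) (proj₁ image) , via-μ^ (s≤s bs≤K) (proj₂ image)
  where
  K : ℕ
  K = k + k
  k<|μ^K| : k < length (μ^ K)
  k<|μ^K| = ≤-trans (s≤s (m≤m+n k k)) (length-μ^ K)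
  rank≡ : rank k ≡ zeros (index (μ^ K)) 0 k
  rank≡ = zeros-cong 0 k (λ j j<k → fib≡index-μ^ K (<-trans j<k k<|μ^K|))
  image : index (μ^ (suc K)) (blockStart k) ≡ false × index (μ^ (suc K)) (suc (blockStart k)) ≡ not (fib k)
  image rewrite rank≡ | fib≡index-μ^ K k<|μ^K| = index-concatMap-μ (μ^ K) k k<|μ^K|
  bs≤K : blockStart k ≤ K
  bs≤K = +-monoʳ-≤ k (zeros-≤ fib 0 k)
  via-μ^ : ∀ {j b} → j ≤ suc K → index (μ^ (suc K)) j ≡ b → fib j ≡ b
  via-μ^ j≤ = trans (fib≡index-μ^ (suc K) (≤-<-trans j≤ (length-μ^ (suc K))))

fib-blockStart : ∀ k → fib (blockStart k) ≡ false
fib-blockStart k = proj₁ (fib-block k)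

fib-suc-blockStart : ∀ k {b} → fib k ≡ b → fib (suc (blockStart k)) ≡ not b
fib-suc-blockStart k refl = proj₂ (fib-block k)

blockStart-suc : ∀ k {b} → fib k ≡ b → blockStart (suc k) ≡ suc (χ₀ b + blockStart k)
blockStart-suc k refl = trans (cong (suc ∘ (k +_)) (zeros-snoc fib 0 k)) (cong suc (rearrange k (rank k) _))
  where
  rearrange : ∀ k r c → k + (r + c) ≡ c + (k + r)
  rearrange = solve-∀

blockStart-mono : ∀ {k l} → k ≤ l → blockStart k ≤ blockStart l
blockStart-mono k≤l = +-mono-≤ k≤l (zeros-mono fib 0 k≤l)

data BlockView : ℕ → Set where
  first  : ∀ k → BlockView (blockStart k)
  second : ∀ k → fib k ≡ false → BlockView (suc (blockStart k))

blockView : ∀ j → BlockView j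
blockView zero = first 0
blockView (suc j) with blockView j
... | second k fk≡0 = subst BlockView (blockStart-suc k fk≡0) (first (suc k))
... | first k with fib k in fk
...   | true  = subst BlockView (blockStart-suc k fk) (first (suc k))
...   | false = second k fk

rank-blockStart : ∀ k → rank (blockStart k) ≡ k

rank-suc-blockStart : ∀ k → rank (suc (blockStart k)) ≡ suc k
rank-suc-blockStart k = begin
  rank (suc (blockStart k))                     ≡⟨ zeros-snoc fib 0 (blockStart k) ⟩
  rank (blockStart k) + χ₀ (fib (blockStart k)) ≡⟨ cong₂ (λ r b → r + χ₀ b)
                                                           (rank-blockStart k) (fib-blockStart k) ⟩
  k + 1                                         ≡⟨ +-comm k 1 ⟩
  suc k                                         ∎
  where open ≡-Reasoning

rank-blockStart zero = refl
rank-blockStart (suc k) with fib k in fk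
... | true  = trans (cong rank (blockStart-suc k fk)) (rank-suc-blockStart k)
... | false = begin
  rank (blockStart (suc k))                                 ≡⟨ cong rank (blockStart-suc k fk) ⟩
  rank (suc (suc (blockStart k)))                           ≡⟨ zeros-snoc fib 0 (suc (blockStart k)) ⟩
  rank (suc (blockStart k)) + χ₀ (fib (suc (blockStart k))) ≡⟨ cong₂ (λ r b → r + χ₀ b)
                                                                (rank-suc-blockStart k) (fib-suc-blockStart k fk) ⟩
  suc k + 0                                                 ≡⟨ +-identityʳ (suc k) ⟩
  suc k                                                     ∎
  where open ≡-Reasoning

blockStart-rank : ∀ j → fib j ≡ false → blockStart (rank j) ≡ j
blockStart-rank j fj≡0 with blockView j
... | first k       = cong blockStart (rank-blockStart k)
... | second k fk≡0 = contradiction (fib-suc-blockStart k fk≡0) (not-¬ fj≡0)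

blockStart-< : ∀ {k j} → k < rank j → blockStart k < j
blockStart-< {k} {j} k<rank-j =
  ≰⇒> λ j≤bs → <⇒≱ k<rank-j (≤-trans (zeros-mono fib 0 j≤bs) (≤-reflexive (rank-blockStart k)))

no-11 : ∀ j → fib j ≡ true → fib (suc j) ≡ false
no-11 j fj≡1 with blockView j
... | first k       = contradiction (fib-blockStart k) (not-¬ fj≡1)
... | second k fk≡0 = subst (λ x → fib x ≡ false) (blockStart-suc k fk≡0) (fib-blockStart (suc k))

0-before-1 : ∀ j → fib (suc j) ≡ true → fib j ≡ false
0-before-1 j fsj≡1 with fib j in fj
... | false = refl
... | true  = contradiction (no-11 j fj) (not-¬ fsj≡1)

no-000 : ∀ j → fib j ≡ false → fib (suc j) ≡ false → fib (suc (suc j)) ≡ false → ⊥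
no-000 j fj≡0 fsj≡0 fssj≡0 with blockView j
... | second k fk≡0 = contradiction (fib-suc-blockStart k fk≡0) (not-¬ fj≡0)
... | first k with fib k in fk
...   | false = contradiction (fib-suc-blockStart k fk) (not-¬ fsj≡0)
...   | true  = contradiction fssk≡1 (not-¬ fssj≡0)
  where
  fssk≡1 : fib (suc (suc (blockStart k))) ≡ true
  fssk≡1 = subst (λ x → fib (suc x) ≡ true) (blockStart-suc k fk) (fib-suc-blockStart (suc k) (no-11 k fk))

1-after-0 : ∀ i → fib i ≡ false → fib (suc i) ≡ true ⊎ fib (suc (suc i)) ≡ true
1-after-0 i fi≡0 with fib (suc i) in fsi | fib (suc (suc i)) in fssi
... | true  | _     = inj₁ refl
... | false | true  = inj₂ refl
... | false | false = ⊥-elim (no-000 i fi≡0 fsi fssi)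

zeros-fib-3 : ∀ i → zeros fib i 3 ≤ 2
zeros-fib-3 i = χ₀-sum≤2 (fib i) (fib (suc i)) (fib (suc (suc i))) (no-000 i)
  where
  χ₀-sum≤2 : ∀ x y z → (x ≡ false → y ≡ false → z ≡ false → ⊥) →
             χ₀ x + (χ₀ y + (χ₀ z + 0)) ≤ 2
  χ₀-sum≤2 false false false ¬000 = ⊥-elim (¬000 refl refl refl)
  χ₀-sum≤2 false false true  _    = ≤-refl
  χ₀-sum≤2 false true  false _    = ≤-refl
  χ₀-sum≤2 false true  true  _    = s≤s z≤n
  χ₀-sum≤2 true  false false _    = ≤-refl
  χ₀-sum≤2 true  false true  _    = s≤s z≤n
  χ₀-sum≤2 true  true  false _    = s≤s z≤n
  χ₀-sum≤2 true  true  true  _    = z≤n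

-- Runs in the Fibonacci word

Run : ℕ → ℕ → ℕ → Set
Run i d m = ∀ x → i ≤ x → x < i + m → fib x ≡ fib (x + d)

run-zeros-shift : ∀ {i d m} → Run i d m → ∀ e → e ≤ m → zeros fib (i + e) d ≡ zeros fib i d
run-zeros-shift {i} {d} run zero    _  = cong (λ j → zeros fib j d) (+-identityʳ i)
run-zeros-shift {i} {d} run (suc e) e<m = begin
  zeros fib (i + suc e) d  ≡⟨ cong (λ j → zeros fib j d) (+-suc i e) ⟩
  zeros fib (suc (i + e)) d ≡⟨ zeros-slide fib (i + e) d (run (i + e) (m≤m+n i e) (+-monoʳ-< i e<m)) ⟩
  zeros fib (i + e) d      ≡⟨ run-zeros-shift run e (<⇒≤ e<m) ⟩
  zeros fib i d            ∎
  where open ≡-Reasoning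

run-zeros-periodic : ∀ {i d m} → Run i d m → ∀ t → t * d ≤ m →
                     zeros fib i (suc t * d) ≡ suc t * zeros fib i d
run-zeros-periodic {i} {d} run zero    _ = trans (cong (zeros fib i) (+-identityʳ d)) (sym (+-identityʳ _))
run-zeros-periodic {i} {d} run (suc t) le = begin
  zeros fib i (d + suc t * d)                           ≡⟨ cong (zeros fib i) (+-comm d (suc t * d)) ⟩
  zeros fib i (suc t * d + d)                           ≡⟨ zeros-+ fib i (suc t * d) d ⟩
  zeros fib i (suc t * d) + zeros fib (i + suc t * d) d ≡⟨ cong₂ _+_
                                                             (run-zeros-periodic run t (≤-trans (m≤n+m (t * d) d) le))
                                                             (run-zeros-shift run (suc t * d) le) ⟩
  suc t * zeros fib i d + zeros fib i d                 ≡⟨ +-comm (suc t * zeros fib i d) _ ⟩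
  suc (suc t) * zeros fib i d                           ∎
  where open ≡-Reasoning

run-zeros-bound : ∀ {i d m} → Run i d m → 3 * d ≤ m → ∀ l → 4 * d ≤ l + 3 →
                  4 * zeros fib i d ≤ zeros fib i l + 2
run-zeros-bound {i} {d} run 3d≤m l 4d≤l+3 = begin
  4 * zeros fib i d                   ≡⟨ run-zeros-periodic run 3 3d≤m ⟨
  zeros fib i (4 * d)                 ≤⟨ zeros-mono fib i 4d≤l+3 ⟩
  zeros fib i (l + 3)                 ≡⟨ zeros-+ fib i l 3 ⟩
  zeros fib i l + zeros fib (i + l) 3 ≤⟨ +-monoʳ-≤ (zeros fib i l) (zeros-fib-3 (i + l)) ⟩
  zeros fib i l + 2                   ∎
  where open ≤-Reasoning

-- The block of k starts at j and, as fib (j + d) = fib j = 0, that of k + d′ at j + d;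
-- the letters following these block starts are not (fib k) and not (fib (k + d′)).
run-desubstitute : ∀ {i d m} → fib i ≡ false → Run i d (suc m) →
                   Run (rank i) (zeros fib i d) (zeros fib i m)
run-desubstitute {i} {d} {m} fi≡0 run k rank-i≤k k< = not-injective (begin
  not (fib k)                           ≡⟨ fib-suc-blockStart k refl ⟨
  fib (suc j)                           ≡⟨ run (suc j) (m≤n⇒m≤1+n i≤j) sj<i+sm ⟩
  fib (suc (j + d))                     ≡⟨ cong (fib ∘ suc) (blockStart-rank (j + d) fj+d≡0) ⟨
  fib (suc (blockStart (rank (j + d)))) ≡⟨ cong (fib ∘ suc ∘ blockStart) rank-j+d ⟩
  fib (suc (blockStart (k + d′)))       ≡⟨ fib-suc-blockStart (k + d′) refl ⟩
  not (fib (k + d′))                    ∎)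
  where
  open ≡-Reasoning
  j d′ : ℕ
  j = blockStart k
  d′ = zeros fib i d
  i≤j : i ≤ j
  i≤j = subst (_≤ j) (blockStart-rank i fi≡0) (blockStart-mono rank-i≤k)
  j<i+m : j < i + m
  j<i+m = blockStart-< (subst (k <_) (sym (zeros-+ fib 0 i m)) k<)
  fj+d≡0 : fib (j + d) ≡ false
  fj+d≡0 = trans (sym (run j i≤j (<-trans j<i+m (+-monoʳ-< i (n<1+n m))))) (fib-blockStart k)
  sj<i+sm : suc j < i + suc m
  sj<i+sm = subst (suc j <_) (sym (+-suc i m)) (s≤s j<i+m)
  j∸i≤m : j ∸ i ≤ suc m
  j∸i≤m = m≤n⇒m≤1+n (subst (j ∸ i ≤_) (m+n∸m≡n i m) (∸-monoˡ-≤ i (<⇒≤ j<i+m)))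
  zeros-at-j : zeros fib j d ≡ d′
  zeros-at-j = subst (λ x → zeros fib x d ≡ d′) (m+[n∸m]≡n i≤j) (run-zeros-shift run (j ∸ i) j∸i≤m)
  rank-j+d : rank (j + d) ≡ k + d′
  rank-j+d = trans (zeros-+ fib 0 j d) (cong₂ _+_ (rank-blockStart k) zeros-at-j)

zeros-<-period : ∀ {i e m} → fib i ≡ false → 0 < m → Run i (2 + e) m → zeros fib i (2 + e) < 2 + e
zeros-<-period {i} {zero} {m} fi≡0 0<m run with 1-after-0 i fi≡0
... | inj₁ fsi≡1  = zeros-< fib i 1 (s≤s (s≤s z≤n)) fsi≡1
... | inj₂ fssi≡1 =
  contradiction (trans (run i ≤-refl (m<m+n i 0<m)) (trans (cong fib (+-comm i 2)) fssi≡1)) (not-¬ fi≡0)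
zeros-<-period {i} {suc e} fi≡0 _ _ with 1-after-0 i fi≡0
... | inj₁ fsi≡1  = zeros-< fib i 1 (s≤s (s≤s z≤n)) fsi≡1
... | inj₂ fssi≡1 = zeros-< fib i 2 (s≤s (s≤s (s≤s z≤n))) fssi≡1

run-extendˡ : ∀ {i d m} → fib (suc i) ≡ true → 0 < m → Run (suc i) d m → Run i d (suc m)
run-extendˡ {i} {d} {m} fsi≡1 0<m run x i≤x x< with i ≟ x
... | yes refl = trans (0-before-1 i fsi≡1)
                       (sym (0-before-1 (i + d) (trans (sym (run (suc i) ≤-refl (m<m+n (suc i) 0<m))) fsi≡1)))
... | no i≢x   = run x (≤∧≢⇒< i≤x i≢x) (subst (x <_) (+-suc i m) x<)

NoLongRun : ℕ → Set
NoLongRun d = 1 ≤ d → ∀ i m → 4 * d ≤ m + 2 → ¬ Run i d m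

long-run-2≤m : ∀ {d m} → 1 ≤ d → 4 * d ≤ m + 2 → 2 ≤ m
long-run-2≤m {d} {m} 1≤d bound = +-cancelʳ-≤ 2 2 m (≤-trans (*-monoʳ-≤ 4 1≤d) bound)

long-run-3d≤m : ∀ {d m} → 2 ≤ d → 4 * d ≤ m + 2 → 3 * d ≤ m
long-run-3d≤m {d} {m} 2≤d bound = +-cancelʳ-≤ 2 (3 * d) m (begin
  3 * d + 2  ≤⟨ +-monoʳ-≤ (3 * d) 2≤d ⟩
  3 * d + d  ≡⟨ +-comm (3 * d) d ⟩
  4 * d      ≤⟨ bound ⟩
  m + 2      ∎)
  where open ≤-Reasoning

no-long-run-at-0 : ∀ {d} → (∀ {d′} → d′ < d → NoLongRun d′) →
                   ∀ {i m} → fib i ≡ false → 1 ≤ d → 4 * d ≤ m + 2 → ¬ Run i d m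
no-long-run-at-0 {1} _ {i} {m} fi≡0 1≤d bound run =
  no-000 i fi≡0 fsi≡0 (trans (next (suc i) (n≤1+n i) si<i+m) fsi≡0)
  where
  2≤m : 2 ≤ m
  2≤m = long-run-2≤m 1≤d bound
  next : ∀ x → i ≤ x → x < i + m → fib (suc x) ≡ fib x
  next x i≤x x< = trans (cong fib (+-comm 1 x)) (sym (run x i≤x x<))
  si<i+m : suc i < i + m
  si<i+m = subst (_≤ i + m) (+-comm i 2) (+-monoʳ-≤ i 2≤m)
  fsi≡0 : fib (suc i) ≡ false
  fsi≡0 = trans (next i ≤-refl (<-trans (n<1+n i) si<i+m)) fi≡0
no-long-run-at-0 {suc (suc e)} _ {i} {zero} _ _ bound _ =
  contradiction (long-run-3d≤m {m = 0} (s≤s (s≤s z≤n)) bound) λ ()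
no-long-run-at-0 {suc (suc e)} rec {i} {suc m} fi≡0 _ bound run =
  rec (zeros-<-period fi≡0 (s≤s z≤n) run) 1≤d′ (rank i) (zeros fib i m)
      (run-zeros-bound run (long-run-3d≤m (s≤s (s≤s z≤n)) bound) m 4d≤m+3)
      (run-desubstitute fi≡0 run)
  where
  4d≤m+3 : 4 * suc (suc e) ≤ m + 3
  4d≤m+3 = subst (4 * suc (suc e) ≤_) (sym (+-suc m 2)) bound
  1≤d′ : 1 ≤ zeros fib i (suc (suc e))
  1≤d′ rewrite fi≡0 = s≤s z≤n

no-long-run : ∀ d → NoLongRun d
no-long-run = <-rec NoLongRun step
  where
  step : ∀ d → (∀ {d′} → d′ < d → NoLongRun d′) → NoLongRun d
  step d rec 1≤d zero    m bound run = no-long-run-at-0 rec refl 1≤d bound run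
  step d rec 1≤d (suc i) m bound run with fib (suc i) in fsi
  ... | false = no-long-run-at-0 rec fsi 1≤d bound run
  ... | true  = no-long-run-at-0 rec (0-before-1 i fsi) 1≤d (≤-trans bound (n≤1+n _))
                  (run-extendˡ fsi (<⇒≤ (long-run-2≤m 1≤d bound)) run)

OccursAt : ℕ → List Bool → Set
OccursAt i w = w ≡ map (λ k → fib (i + k)) (upTo (length w))

applyUpTo-! : ∀ (f : ℕ → Bool) {n j} → j < n → applyUpTo f n ! j ≡ just (f j)
applyUpTo-! f {suc n} {zero}  _         = refl
applyUpTo-! f {suc n} {suc j} (s≤s j<n) = applyUpTo-! (f ∘ suc) j<n

occursAt-! : ∀ {i w j} → OccursAt i w → j < length w → w ! j ≡ just (fib (i + j))
occursAt-! {i} {w} {j} w≡ j<n =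
  trans (cong (_! j) w≡) (trans (cong (_! j) (map-upTo _ (length w))) (applyUpTo-! _ j<n))

periods⇒run : ∀ {i w p q} → OccursAt i w → HasPeriod w p → HasPeriod w q → p ≤ q → q ≤ length w →
              Run (i + p) (q ∸ p) (length w ∸ q)
periods⇒run {i} {w} {p} {q} occ (_ , per-p) (_ , per-q) p≤q q≤n x i+p≤x x<
  with m≤n⇒∃[o]m+o≡n i+p≤x
... | j , refl = just-injective (begin
  just (fib (i + p + j))            ≡⟨ cong (just ∘ fib) (trans (+-assoc i p j) (cong (i +_) (+-comm p j))) ⟩
  just (fib (i + (j + p)))          ≡⟨ occursAt-! {i} {w} occ j+p<n ⟨
  w ! (j + p)                       ≡⟨ per-p j j+p<n ⟨
  w ! j                             ≡⟨ per-q j j+q<n ⟩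
  w ! (j + q)                       ≡⟨ occursAt-! {i} {w} occ j+q<n ⟩
  just (fib (i + (j + q)))          ≡⟨ cong (just ∘ fib) shuffle ⟩
  just (fib (i + p + j + (q ∸ p)))  ∎)
  where
  open ≡-Reasoning
  j+q<n : j + q < length w
  j+q<n = m≤o∸n⇒m+n≤o (suc j) q≤n (+-cancelˡ-< (i + p) j _ x<)
  j+p<n : j + p < length w
  j+p<n = ≤-<-trans (+-monoʳ-≤ j p≤q) j+q<n
  shuffle : i + (j + q) ≡ i + p + j + (q ∸ p)
  shuffle = begin
    i + (j + q)              ≡⟨ cong (λ q → i + (j + q)) (m+[n∸m]≡n p≤q) ⟨
    i + (j + (p + (q ∸ p)))  ≡⟨ rearrange i j p (q ∸ p) ⟩
    i + p + j + (q ∸ p)      ∎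
    where
    rearrange : ∀ i j p d → i + (j + (p + d)) ≡ i + p + j + d
    rearrange = solve-∀

ratio<8/5⇒ratio<φ : ∀ a q → 5 * a < 8 * q → a * a < a * q + q * q
ratio<8/5⇒ratio<φ a zero       ()
ratio<8/5⇒ratio<φ a q@(suc _) 5a<8q = *-cancelˡ-< 25 (a * a) (a * q + q * q) (begin-strict
  25 * (a * a)                    ≡⟨ square-5 a ⟩
  5 * a * (5 * a)                 ≤⟨ *-monoʳ-≤ (5 * a) (<⇒≤ 5a<8q) ⟩
  5 * a * (8 * q)                 ≡⟨ split-8q a q ⟩
  25 * (a * q) + 3 * q * (5 * a)  ≤⟨ +-monoʳ-≤ (25 * (a * q)) (*-monoʳ-≤ (3 * q) (<⇒≤ 5a<8q)) ⟩
  25 * (a * q) + 3 * q * (8 * q)  ≡⟨ cong (25 * (a * q) +_) (collect-q² q) ⟩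
  25 * (a * q) + 24 * (q * q)     <⟨ +-monoʳ-< (25 * (a * q)) (*-monoˡ-< (q * q) (n<1+n 24)) ⟩
  25 * (a * q) + 25 * (q * q)     ≡⟨ *-distribˡ-+ 25 (a * q) (q * q) ⟨
  25 * (a * q + q * q)            ∎)
  where
  open ≤-Reasoning
  square-5 : ∀ a → 25 * (a * a) ≡ 5 * a * (5 * a)
  square-5 = solve-∀
  split-8q : ∀ a q → 5 * a * (8 * q) ≡ 25 * (a * q) + 3 * q * (5 * a)
  split-8q = solve-∀
  collect-q² : ∀ q → 3 * q * (8 * q) ≡ 24 * (q * q)
  collect-q² = solve-∀

5*2m<8*[p+d] : ∀ {m p d} → m < p → m ≤ 4 * d → 5 * (2 * m) < 8 * (p + d)
5*2m<8*[p+d] {m} {p} {d} m<p m≤4d = begin-strict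
  5 * (2 * m)          ≡⟨ split-10m m ⟩
  8 * m + 2 * m        <⟨ +-mono-<-≤ (*-monoʳ-< 8 m<p) (*-monoʳ-≤ 2 m≤4d) ⟩
  8 * p + 2 * (4 * d)  ≡⟨ collect-8 p d ⟩
  8 * (p + d)          ∎
  where
  open ≤-Reasoning
  split-10m : ∀ m → 5 * (2 * m) ≡ 8 * m + 2 * m
  split-10m = solve-∀
  collect-8 : ∀ p d → 8 * p + 2 * (4 * d) ≡ 8 * (p + d)
  collect-8 = solve-∀

-- The hypothesis w ≢ [] is implied by 0 < q ≤ length w.
lemma11 : (w : List Bool) → w ≢ [] → Factor w →
          (p q : ℕ) → LeastPeriod w p →
          HasPeriod w q → p < q → q ≤ length w → Primitive (take q w) →
          ExpBelowOnePlusHalfPhi (length w) q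
lemma11 w _ (i , occ) p q lp per-q p<q q≤n prim =
  ratio<8/5⇒ratio<φ (2 * m) q
    (subst (λ q → 5 * (2 * m) < 8 * q) (m+[n∸m]≡n (<⇒≤ p<q)) (5*2m<8*[p+d] m<p m≤4d))
  where
  m d : ℕ
  m = length w ∸ q
  d = q ∸ p
  m<p : m < p
  m<p = subst (m <_) (m+n∸n≡m p q) (∸-monoˡ-< (primitive⇒length<p+q lp per-q p<q q≤n prim) q≤n)
  run : Run (i + p) d m
  run = periods⇒run {i} {w} occ (proj₁ lp) per-q (<⇒≤ p<q) q≤n
  m≤4d : m ≤ 4 * d
  m≤4d = ≤-trans (m≤m+n m 2) (<⇒≤ (≰⇒> λ 4d≤m+2 → no-long-run d (m<n⇒0<n∸m p<q) (i + p) m 4d≤m+2 run))
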